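{- Let $T$ be a complete theory and $1<k<\omega$. A partitioned formula $\varphi(x;y)$ is $\mathrm{PM}^{(k)}$ in $T$ if and only if $\varphi$ realizes every finite $k$-hypergraph $(n,E)$, i.e. there are $(b_i)_{i<n}$ in a monster model of $T$ such that (i) for any pairwise distinct $i_0,\dots,i_{k-1}\in n$ with $\neg E(i_0,\dots,i_{k-1})$, the type $\{\varphi(x;b_{i_j}):j<k\}$ is inconsistent, and (ii) for every clique $\{i_0,\dots,i_{l-1}\}\subseteq n$, the type $\{\varphi(x;b_{i_j}):j<l\}$ is consistent.
   Context: A $k$-hypergraph on vertex set $n=\{0,\dots,n-1\}$ is given by a set $E$ of $k$-element subsets of $n$ (hyperedges); $E(i_0,\dots,i_{k-1})$ means $\{i_0,\dots,i_{k-1}\}\in E$. A clique is a set of vertices all of whose $k$-element subsets are hyperedges. An $n$-pattern is $(\mathcal{C},\mathcal{I})$ with $\mathcal{C},\mathcal{I}\subseteq(\mathcal{P}(n)\times\mathcal{P}(n))\setminus\{(\emptyset,\emptyset)\}$; $\varphi$ exhibits it in $T$ if there are $b_0,\dots,b_{n-1}$ in a monster model such that for each $(A^+,A^-)\in\mathcal{C}$ the type $\{\varphi(x;b_i):i\in A^+\}\cup\{\neg\varphi(x;b_j):j\in A^-\}$ is consistent and for each $(Z^+,Z^-)\in\mathcal{I}$ the analogous type is inconsistent. A pattern is reasonable if for all $(Z^+,Z^-)\in\mathcal{I}$, $(Y^+,Y^-)\in\mathcal{C}$ some $\epsilon\in\{+,-\}$ has $Z^\epsilon\not\subseteq Y^\epsilon$,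 and $X^+\cap X^-=\emptyset$ for every condition; positive if every condition has $X^-=\emptyset$. $\varphi$ is $\mathrm{PM}^{(k)}$ if for every $n<\omega$ it exhibits every reasonable positive $n$-pattern all of whose inconsistency conditions $(Z^+,\emptyset)$ satisfy $|Z^+|=k$. -}

module Defs where

open import Data.Nat using (ℕ; _<_)
open import Data.Fin using (Fin)
open import Data.Fin.Subset using (Subset; _∈_; _⊆_; ∣_∣; Empty) renaming (⊥ to ∅)
open import Data.Product using (Σ; ∃; _×_; _,_; proj₁; proj₂)
open import Data.Sum using (_⊎_)
open import Relation.Nullary using (¬_)
open import Relation.Binary.PropositionalEquality using (_≡_; _≢_)

Cond : ℕ → Set
Cond n = Subset n × Subset n

-- The monster model is represented abstractly: X is the sort of x-tuples,
-- Y the sort of y-tuples (parameters) in the monster model, and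
-- φ a b  means  ⊨ φ(a; b).  In a monster model a finite partial type over
-- parameters is consistent iff it is realized, so consistency of
-- {φ(x;b_i) : i ∈ A⁺} ∪ {¬φ(x;b_j) : j ∈ A⁻} is realizability.
module _ {X Y : Set} (φ : X → Y → Set) where

  Consistent : {n : ℕ} → (Fin n → Y) → Cond n → Set
  Consistent b (P , N) =
    ∃ λ a → (∀ i → i ∈ P → φ a (b i)) × (∀ j → j ∈ N → ¬ φ a (b j))

  Exhibits : {n : ℕ} → (Cond n → Set) → (Cond n → Set) → Set
  Exhibits {n} 𝒞 ℐ = Σ (Fin n → Y) λ b →
    (∀ c → 𝒞 c → Consistent b c) × (∀ c → ℐ c → ¬ Consistent b c)

  Realizes : (k n : ℕ) → (Subset n → Set) → Set
  Realizes k n E = Σ (Fin n → Y) λ b →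
    (∀ Z → ∣ Z ∣ ≡ k → ¬ E Z → ¬ Consistent b (Z , ∅)) ×
    (∀ A → IsClique k E A → Consistent b (A , ∅))
    where
    IsClique : (k : ℕ) → (Subset n → Set) → Subset n → Set
    IsClique k E A = ∀ Z → Z ⊆ A → ∣ Z ∣ ≡ k → E Z

IsPattern : {n : ℕ} → (Cond n → Set) → (Cond n → Set) → Set
IsPattern {n} 𝒞 ℐ = ∀ c → 𝒞 c ⊎ ℐ c → c ≢ (∅ , ∅)

Reasonable : {n : ℕ} → (Cond n → Set) → (Cond n → Set) → Set
Reasonable 𝒞 ℐ =
  (∀ z y → ℐ z → 𝒞 y → ¬ (proj₁ z ⊆ proj₁ y) ⊎ ¬ (proj₂ z ⊆ proj₂ y)) ×
  (∀ c → 𝒞 c ⊎ ℐ c → ∀ i → i ∈ proj₁ c → i ∈ proj₂ c → Data.Empty.⊥)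
  where import Data.Empty

Positive : {n : ℕ} → (Cond n → Set) → (Cond n → Set) → Set
Positive 𝒞 ℐ = ∀ c → 𝒞 c ⊎ ℐ c → Empty (proj₂ c)

InconsSize : (k : ℕ) {n : ℕ} → (Cond n → Set) → Set
InconsSize k ℐ = ∀ c → ℐ c → ∣ proj₁ c ∣ ≡ k

IsHypergraph : (k n : ℕ) → (Subset n → Set) → Set
IsHypergraph k n E = ∀ Z → E Z → ∣ Z ∣ ≡ k

PM : {X Y : Set} → (X → Y → Set) → ℕ → Set₁
PM φ k = ∀ (n : ℕ) (𝒞 ℐ : Cond n → Set) →
  IsPattern 𝒞 ℐ → Reasonable 𝒞 ℐ → Positive 𝒞 ℐ → InconsSize k ℐ →
  Exhibits φ 𝒞 ℐ

RealizesAllHypergraphs : {X Y : Set} → (X → Y → Set) → ℕ → Set₁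
RealizesAllHypergraphs φ k = ∀ (n : ℕ) (E : Subset n → Set) →
  IsHypergraph k n E → Realizes φ k n E

-- A witness of PM for the positive pattern whose consistency conditions are the
-- nonempty cliques of a hypergraph and whose inconsistency conditions are its
-- k-element non-edges realizes the hypergraph; the empty clique only needs some
-- element of X, which PM provides through a one-vertex pattern.  Conversely, a
-- reasonable positive pattern is exhibited by any realization of the hypergraph
-- whose edges are the k-sets not occurring as inconsistency conditions, since
-- reasonableness says precisely that the positive part of every consistency
-- condition is a clique of it.
module Submission where

open import Defs
open import Data.Nat using (ℕ; _<_)
open import Data.Nat.Properties using (m<n⇒n≢0)
open import Data.Fin using (Fin)
open import Data.Fin.Subset using (Subset; _∈_; _⊆_; ∣_∣; Empty; Nonempty; ⊤) renaming (⊥ to ∅)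
open import Data.Fin.Subset.Properties using (∉⊥; ⊥⊆; ⊆-refl; ∣⊥∣≡0; nonempty?)
open import Data.Product using (_×_; _,_; proj₁; proj₂)
open import Data.Sum using (_⊎_; inj₁; inj₂)
open import Data.Empty using (⊥; ⊥-elim)
open import Function.Base using (_∘′_)
open import Function.Bundles using (_⇔_; mk⇔)
open import Relation.Nullary using (¬_; yes; no)
open import Relation.Binary.PropositionalEquality using (_≡_; _≢_; refl; sym; trans; cong)

private variable
  n k : ℕ

IsClique : (k : ℕ) → (Subset n → Set) → Subset n → Set
IsClique k E A = ∀ Z → Z ⊆ A → ∣ Z ∣ ≡ k → E Z

∣Z∣≡k⇒Z≢∅ : k ≢ 0 → {Z : Subset n} → ∣ Z ∣ ≡ k → Z ≢ ∅
∣Z∣≡k⇒Z≢∅ {n = n} k≢0 ∣Z∣≡k refl = k≢0 (trans (sym ∣Z∣≡k) (∣⊥∣≡0 n))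

Positive⇒disjoint : {𝒞 ℐ : Cond n → Set} → Positive 𝒞 ℐ →
  ∀ c → 𝒞 c ⊎ ℐ c → ∀ i → i ∈ proj₁ c → i ∈ proj₂ c → ⊥
Positive⇒disjoint positive c c∈ i _ i∈ = positive c c∈ (i , i∈)

cliqueConditions : (k : ℕ) → (Subset n → Set) → Cond n → Set
cliqueConditions k E (A , N) = IsClique k E A × N ≡ ∅ × Nonempty A

nonEdgeConditions : (k : ℕ) → (Subset n → Set) → Cond n → Set
nonEdgeConditions k E (Z , N) = ∣ Z ∣ ≡ k × ¬ E Z × N ≡ ∅

module _ (E : Subset n → Set) where

  hypergraphPattern-isPattern : k ≢ 0 →
    IsPattern (cliqueConditions k E) (nonEdgeConditions k E)
  hypergraphPattern-isPattern _   (A , N) (inj₁ (_ , _ , (i , i∈A))) refl = ∉⊥ i∈A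
  hypergraphPattern-isPattern k≢0 (Z , N) (inj₂ (∣Z∣≡k , _ , _)) Z,N≡∅,∅ =
    ∣Z∣≡k⇒Z≢∅ k≢0 ∣Z∣≡k (cong proj₁ Z,N≡∅,∅)

  hypergraphPattern-positive : Positive (cliqueConditions k E) (nonEdgeConditions k E)
  hypergraphPattern-positive (A , N) (inj₁ (_ , refl , _)) (i , i∈) = ∉⊥ i∈
  hypergraphPattern-positive (Z , N) (inj₂ (_ , _ , refl)) (i , i∈) = ∉⊥ i∈

  hypergraphPattern-reasonable : Reasonable (cliqueConditions k E) (nonEdgeConditions k E)
  hypergraphPattern-reasonable = separated , Positive⇒disjoint hypergraphPattern-positive
    where
    separated : ∀ z y → nonEdgeConditions k E z → cliqueConditions k E y →
      ¬ (proj₁ z ⊆ proj₁ y) ⊎ ¬ (proj₂ z ⊆ proj₂ y)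
    separated (Z , _) (A , _) (∣Z∣≡k , ¬EZ , _) (clique , _ , _) =
      inj₁ λ Z⊆A → ¬EZ (clique Z Z⊆A ∣Z∣≡k)

patternHypergraph : (k : ℕ) → (Cond n → Set) → Subset n → Set
patternHypergraph k ℐ Z = ∣ Z ∣ ≡ k × (∀ N → ¬ ℐ (Z , N))

module _ {𝒞 ℐ : Cond n → Set} (reasonable : Reasonable 𝒞 ℐ) (positive : Positive 𝒞 ℐ) where

  consistencyCondition⇒IsClique : ∀ {A N} → 𝒞 (A , N) → IsClique k (patternHypergraph k ℐ) A
  consistencyCondition⇒IsClique {A = A} {N} A,N∈𝒞 Z Z⊆A ∣Z∣≡k = ∣Z∣≡k , notInconsistency
    where
    notInconsistency : ∀ M → ¬ ℐ (Z , M)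
    notInconsistency M Z,M∈ℐ with proj₁ reasonable (Z , M) (A , N) Z,M∈ℐ A,N∈𝒞
    ... | inj₁ Z⊈A = Z⊈A Z⊆A
    ... | inj₂ M⊈N = M⊈N λ {i} i∈M → ⊥-elim (positive (Z , M) (inj₂ Z,M∈ℐ) (i , i∈M))

module _ {X Y : Set} (φ : X → Y → Set) where

  Consistent-mono : {b : Fin n → Y} {P P′ N N′ : Subset n} → P′ ⊆ P → N′ ⊆ N →
    Consistent φ b (P , N) → Consistent φ b (P′ , N′)
  Consistent-mono P′⊆P N′⊆N (a , satisfies , refutes) =
    a , (λ i i∈P′ → satisfies i (P′⊆P i∈P′)) , (λ j j∈N′ → refutes j (N′⊆N j∈N′))

  Consistent-empty : {b : Fin n → Y} {A : Subset n} → X → Empty A → Consistent φ b (A , ∅)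
  Consistent-empty a A-empty =
    a , (λ i i∈A → ⊥-elim (A-empty (i , i∈A))) , (λ j j∈∅ → ⊥-elim (∉⊥ j∈∅))

  PM⇒inhabited : PM φ k → X
  PM⇒inhabited pm = proj₁ (proj₁ (proj₂ exhibition) (⊤ , ∅) refl)
    where
    𝒞 ℐ : Cond 1 → Set
    𝒞 c = c ≡ (⊤ , ∅)
    ℐ _ = ⊥
    isPattern : IsPattern 𝒞 ℐ
    isPattern _ (inj₁ refl) ()
    positive : Positive 𝒞 ℐ
    positive _ (inj₁ refl) (i , i∈∅) = ∉⊥ i∈∅
    exhibition : Exhibits φ 𝒞 ℐ
    exhibition = pm 1 𝒞 ℐ isPattern ((λ _ _ ()) , Positive⇒disjoint positive) positive (λ _ ())

  Exhibits⇒Realizes : (E : Subset n → Set) → X →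
    Exhibits φ (cliqueConditions k E) (nonEdgeConditions k E) → Realizes φ k n E
  Exhibits⇒Realizes {k = k} E a (b , consistent , inconsistent) =
    b , nonEdge⇒inconsistent , clique⇒consistent
    where
    nonEdge⇒inconsistent : ∀ Z → ∣ Z ∣ ≡ k → ¬ E Z → ¬ Consistent φ b (Z , ∅)
    nonEdge⇒inconsistent Z ∣Z∣≡k ¬EZ = inconsistent (Z , ∅) (∣Z∣≡k , ¬EZ , refl)
    clique⇒consistent : ∀ A → IsClique k E A → Consistent φ b (A , ∅)
    clique⇒consistent A clique with nonempty? A
    ... | yes A-nonempty = consistent (A , ∅) (clique , refl , A-nonempty)
    ... | no A-empty = Consistent-empty a A-empty

  Realizes⇒Exhibits : {𝒞 ℐ : Cond n → Set} →
    Reasonable 𝒞 ℐ → Positive 𝒞 ℐ → InconsSize k ℐ →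
    Realizes φ k n (patternHypergraph k ℐ) → Exhibits φ 𝒞 ℐ
  Realizes⇒Exhibits {𝒞 = 𝒞} {ℐ} reasonable positive inconsSize
                    (b , nonEdge⇒inconsistent , clique⇒consistent) =
    b , consistent , inconsistent
    where
    consistent : ∀ c → 𝒞 c → Consistent φ b c
    consistent (A , N) A,N∈𝒞 =
      Consistent-mono ⊆-refl (λ {i} i∈N → ⊥-elim (positive (A , N) (inj₁ A,N∈𝒞) (i , i∈N)))
        (clique⇒consistent A (consistencyCondition⇒IsClique reasonable positive A,N∈𝒞))
    inconsistent : ∀ c → ℐ c → ¬ Consistent φ b c
    inconsistent (Z , N) Z,N∈ℐ =
      nonEdge⇒inconsistent Z (inconsSize (Z , N) Z,N∈ℐ) (λ edge → proj₂ edge N Z,N∈ℐ)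
      ∘′ Consistent-mono ⊆-refl ⊥⊆

  PM⇒RealizesAllHypergraphs : k ≢ 0 → PM φ k → RealizesAllHypergraphs φ k
  PM⇒RealizesAllHypergraphs k≢0 pm n E _ =
    Exhibits⇒Realizes E (PM⇒inhabited pm)
      (pm n (cliqueConditions _ E) (nonEdgeConditions _ E)
        (hypergraphPattern-isPattern E k≢0) (hypergraphPattern-reasonable E)
        (hypergraphPattern-positive E) (λ _ → proj₁))

  RealizesAllHypergraphs⇒PM : RealizesAllHypergraphs φ k → PM φ k
  RealizesAllHypergraphs⇒PM realize n _ ℐ _ reasonable positive inconsSize =
    Realizes⇒Exhibits reasonable positive inconsSize
      (realize n (patternHypergraph _ ℐ) (λ _ → proj₁))

proposition6p3 : {X Y : Set} (φ : X → Y → Set) (k : ℕ) → 1 < k →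
    PM φ k ⇔ RealizesAllHypergraphs φ k
proposition6p3 φ k 1<k =
  mk⇔ (PM⇒RealizesAllHypergraphs φ (m<n⇒n≢0 1<k)) (RealizesAllHypergraphs⇒PM φ)
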